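{- Let $G$ be a graph with maximum degree at most $\Delta\geq 3$ and diameter at most $k$, and let $(A,S,B)$ be a separation of order $s$ in $G$. Then $$|V(G)|\leq \begin{cases} 3s\,M\!\left(\Delta,\frac{k-1}{2}\right) & \text{if } k \text{ is odd},\\[2pt] \frac{3}{2}\sqrt{s}\,\Delta(\Delta-1)^{k/2-1}+3s\,M\!\left(\Delta,\frac{k}{2}-1\right) & \text{if } k \text{ is even}.\end{cases}$$
   Context: For integers $\Delta\geq 3$ and $j\geq 0$, $M(\Delta,j):=1+\Delta\sum_{i=0}^{j-1}(\Delta-1)^i=\frac{\Delta(\Delta-1)^j-2}{\Delta-2}$ (the Moore bound). A separation of order $s$ in an $n$-vertex graph $G$ is a partition $(A,S,B)$ of $V(G)$ such that $|A|\leq\frac{2}{3}n$, $|B|\leq\frac{2}{3}n$, $|S|\leq s$, and there is no edge between $A$ and $B$. -}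

module Defs where

open import Data.Nat using (ℕ; zero; suc; _+_; _*_; _∸_; _^_; _≤_)
open import Data.Bool using (Bool; true; false)
open import Data.Fin using (Fin)
open import Data.Fin.Subset using (Subset; _∈_; _∉_; ∣_∣)
open import Data.Vec using (tabulate)
open import Data.Product using (_×_)
open import Data.Sum using (_⊎_)
open import Relation.Binary.PropositionalEquality using (_≡_)

-- Moore bound  M(Δ,j) = 1 + Δ * Σ_{i<j} (Δ-1)^i
geomSum : ℕ → ℕ → ℕ
geomSum q zero = 0
geomSum q (suc j) = geomSum q j + q ^ j

M : ℕ → ℕ → ℕ
M Δ j = 1 + Δ * geomSum (Δ ∸ 1) j

record Graph (n : ℕ) : Set where
  field
    adj   : Fin n → Fin n → Bool
    sym   : ∀ u v → adj u v ≡ adj v u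
    irrefl : ∀ v → adj v v ≡ false
open Graph public

N : ∀ {n} → Graph n → Fin n → Subset n
N G v = tabulate (adj G v)

deg : ∀ {n} → Graph n → Fin n → ℕ
deg G v = ∣ N G v ∣

MaxDegreeAtMost : ∀ {n} → Graph n → ℕ → Set
MaxDegreeAtMost G Δ = ∀ v → deg G v ≤ Δ

data WalkWithin {n} (G : Graph n) : ℕ → Fin n → Fin n → Set where
  here : ∀ {l v} → WalkWithin G l v v
  step : ∀ {l u w v} → adj G u w ≡ true → WalkWithin G l w v → WalkWithin G (suc l) u v

DiameterAtMost : ∀ {n} → Graph n → ℕ → Set
DiameterAtMost G k = ∀ u v → WalkWithin G k u v

record IsSeparation {n} (G : Graph n) (s : ℕ) (A S B : Subset n) : Set where
  field
    partition : ∀ v → (v ∈ A × v ∉ S × v ∉ B)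
                    ⊎ (v ∉ A × v ∈ S × v ∉ B)
                    ⊎ (v ∉ A × v ∉ S × v ∈ B)
    sizeA : 3 * ∣ A ∣ ≤ 2 * n
    sizeB : 3 * ∣ B ∣ ≤ 2 * n
    sizeS : ∣ S ∣ ≤ s
    noEdge : ∀ u v → u ∈ A → v ∈ B → adj G u v ≡ false

module Submission where

-- Let T be the set of vertices within distance j of S. By the Moore bound |T| ≤ s M(Δ,j), and
-- since 3|B| ≤ 2n, the part A ∖ T has at least (n − 3 s M(Δ,j))/3 vertices; likewise B ∖ T.
-- A walk from A to B passes through S, so a vertex of A ∖ T and one of B ∖ T are at distance
-- at least 2j + 2. For k = 2j + 1 one of the two parts is therefore empty. For k = 2j + 2 every
-- such pair lies on the sphere of radius j + 1 around a common x ∈ S, so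
-- |A ∖ T| |B ∖ T| ≤ ∑_{x ∈ S} αₓ βₓ with αₓ + βₓ ≤ Δ(Δ−1)^j, and 4 αₓ βₓ ≤ (αₓ + βₓ)².

open import Defs hiding (sym)
open import Data.Nat
open import Data.Nat.Properties
open import Data.Nat.Solver using (module +-*-Solver)
open import Data.Bool using (Bool; true; false)
import Data.Bool.Properties as Bool
open import Data.Empty using (⊥)
open import Data.Fin using (Fin; zero; suc)
import Data.Fin as Fin
import Data.Fin.Properties as Fin
open import Data.Fin.Properties using (any?)
open import Data.Fin.Subset using (Subset; _∈_; _∉_; ∣_∣)
open import Data.Fin.Subset.Properties using (_∈?_)
open import Data.Vec using (_∷_; []; tabulate)
open import Data.Product using (_×_; _,_; ∃; proj₁; proj₂)
open import Data.Sum using (_⊎_; inj₁; inj₂)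
open import Function using (_∘_; id)
open import Level using (0ℓ)
open import Relation.Nullary using (¬_; Dec; yes; no; does; contradiction; _×-dec_; _⊎-dec_; ¬?)
open import Relation.Nullary.Decidable using (map′; dec-true)
open import Relation.Unary using (Pred; Decidable; _⊆_; _∪_; _∩_; ∁)
open import Relation.Unary.Properties using (_∩?_; _∪?_; ∁?; U?)
open import Relation.Binary.PropositionalEquality
open import Algebra.Properties.Semiring.Sum +-*-semiring
  using (sum; sum-syntax; sum-cong-≗; ∑-distrib-+; ∑-comm; *-distribˡ-sum; *-distribʳ-sum)
open +-*-Solver using (solve; _:+_; _:*_; _:^_; _:=_; con)

⟦_⟧ : Bool → ℕ
⟦ true ⟧ = 1
⟦ false ⟧ = 0

count : ∀ {m} {P : Pred (Fin m) 0ℓ} → Decidable P → ℕ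
count {m} P? = ∑[ v < m ] ⟦ does (P? v) ⟧

private
  variable
    m k : ℕ

∑-mono-≤ : {f g : Fin m → ℕ} → (∀ i → f i ≤ g i) → sum f ≤ sum g
∑-mono-≤ {m = zero} le = z≤n
∑-mono-≤ {m = suc m} le = +-mono-≤ (le zero) (∑-mono-≤ (le ∘ suc))

∑-mono-< : {f g : Fin m → ℕ} → (∀ i → f i ≤ g i) → ∀ j → f j < g j → sum f < sum g
∑-mono-< le zero lt = +-mono-<-≤ lt (∑-mono-≤ (le ∘ suc))
∑-mono-< le (suc j) lt = +-mono-≤-< (le zero) (∑-mono-< (le ∘ suc) j lt)

≤-sum : (f : Fin m → ℕ) → ∀ i → f i ≤ sum f
≤-sum f zero = m≤m+n _ _
≤-sum f (suc i) = ≤-trans (≤-sum (f ∘ suc) i) (m≤n+m _ (f zero))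

∑*∑ : (f : Fin m → ℕ) (g : Fin k → ℕ) → sum f * sum g ≡ ∑[ a < m ] ∑[ b < k ] (f a * g b)
∑*∑ f g = trans (*-distribʳ-sum (sum g) f) (sum-cong-≗ (λ a → *-distribˡ-sum (f a) g))

⟦⟧-mono : {P Q : Set} (P? : Dec P) (Q? : Dec Q) → (P → Q) → ⟦ does P? ⟧ ≤ ⟦ does Q? ⟧
⟦⟧-mono (yes _) (yes _) _ = ≤-refl
⟦⟧-mono (yes p) (no ¬q) P⇒Q = contradiction (P⇒Q p) ¬q
⟦⟧-mono (no _) _ _ = z≤n

count-none : {P : Pred (Fin m) 0ℓ} (P? : Decidable P) → (∀ v → ¬ P v) → count P? ≡ 0
count-none {m = zero} P? none = refl
count-none {m = suc m} P? none with P? zero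
... | yes p = contradiction p (none zero)
... | no _ = count-none (P? ∘ suc) (none ∘ suc)

count-all : {P : Pred (Fin m) 0ℓ} (P? : Decidable P) → (∀ v → P v) → count P? ≡ m
count-all {m = zero} P? all = refl
count-all {m = suc m} P? all with P? zero
... | yes _ = cong suc (count-all (P? ∘ suc) (all ∘ suc))
... | no ¬p = contradiction (all zero) ¬p

count-mono : {P Q : Pred (Fin m) 0ℓ} (P? : Decidable P) (Q? : Decidable Q) → P ⊆ Q → count P? ≤ count Q?
count-mono P? Q? P⊆Q = ∑-mono-≤ (λ v → ⟦⟧-mono (P? v) (Q? v) P⊆Q)

count-mono-< : {P Q : Pred (Fin m) 0ℓ} (P? : Decidable P) (Q? : Decidable Q) → P ⊆ Q →
  ∀ {q} → Q q → ¬ P q → count P? < count Q?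
count-mono-< P? Q? P⊆Q {q} Qq ¬Pq = ∑-mono-< (λ v → ⟦⟧-mono (P? v) (Q? v) P⊆Q) q strict
  where
  strict : ⟦ does (P? q) ⟧ < ⟦ does (Q? q) ⟧
  strict with P? q | Q? q
  ... | yes Pq | _ = contradiction Pq ¬Pq
  ... | no _ | yes _ = ≤-refl
  ... | no _ | no ¬Qq = contradiction Qq ¬Qq

count-subsingleton : {P : Pred (Fin m) 0ℓ} (P? : Decidable P) →
  (∀ {u v} → P u → P v → u ≡ v) → count P? ≤ 1
count-subsingleton {m = zero} P? unique = z≤n
count-subsingleton {m = suc m} P? unique with P? zero
... | yes p rewrite count-none (P? ∘ suc) (λ v q → Fin.0≢1+n (unique p q)) = ≤-refl
... | no _ = count-subsingleton (P? ∘ suc) (λ p q → Fin.suc-injective (unique p q))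

count-⊆-∪ : {P Q R : Pred (Fin m) 0ℓ} (P? : Decidable P) (Q? : Decidable Q) (R? : Decidable R) →
  R ⊆ P ∪ Q → count R? ≤ count P? + count Q?
count-⊆-∪ P? Q? R? R⊆P∪Q =
  ≤-trans (∑-mono-≤ pointwise)
          (≤-reflexive (∑-distrib-+ (λ v → ⟦ does (P? v) ⟧) (λ v → ⟦ does (Q? v) ⟧)))
  where
  pointwise : ∀ v → ⟦ does (R? v) ⟧ ≤ ⟦ does (P? v) ⟧ + ⟦ does (Q? v) ⟧
  pointwise v with R? v | P? v | Q? v
  ... | no _ | _ | _ = z≤n
  ... | yes _ | yes _ | _ = s≤s z≤n
  ... | yes _ | no _ | yes _ = ≤-refl
  ... | yes r | no ¬p | no ¬q with R⊆P∪Q r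
  ...   | inj₁ p = contradiction p ¬p
  ...   | inj₂ q = contradiction q ¬q

count-disjoint-⊆ : {P Q R : Pred (Fin m) 0ℓ} (P? : Decidable P) (Q? : Decidable Q) (R? : Decidable R) →
  P ⊆ R → Q ⊆ R → (∀ {v} → P v → ¬ Q v) → count P? + count Q? ≤ count R?
count-disjoint-⊆ P? Q? R? P⊆R Q⊆R disjoint =
  ≤-trans (≤-reflexive (sym (∑-distrib-+ (λ v → ⟦ does (P? v) ⟧) (λ v → ⟦ does (Q? v) ⟧))))
          (∑-mono-≤ pointwise)
  where
  pointwise : ∀ v → ⟦ does (P? v) ⟧ + ⟦ does (Q? v) ⟧ ≤ ⟦ does (R? v) ⟧
  pointwise v with P? v | Q? v | R? v
  ... | yes p | yes q | _ = contradiction q (disjoint p)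
  ... | yes p | no _ | no ¬r = contradiction (P⊆R p) ¬r
  ... | no _ | yes q | no ¬r = contradiction (Q⊆R q) ¬r
  ... | yes _ | no _ | yes _ = ≤-refl
  ... | no _ | yes _ | yes _ = ≤-refl
  ... | no _ | no _ | _ = z≤n

count-≤-∑ : {P : Pred (Fin m) 0ℓ} {Q : Fin k → Pred (Fin m) 0ℓ}
  (P? : Decidable P) (Q? : ∀ x → Decidable (Q x)) →
  (∀ {u} → P u → ∃ λ x → Q x u) → count P? ≤ ∑[ x < k ] count (Q? x)
count-≤-∑ P? Q? cover =
  ≤-trans (∑-mono-≤ pointwise) (≤-reflexive (∑-comm (λ u x → ⟦ does (Q? x u) ⟧)))
  where
  pointwise : ∀ u → ⟦ does (P? u) ⟧ ≤ ∑[ x < _ ] ⟦ does (Q? x u) ⟧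
  pointwise u with P? u
  ... | no _ = z≤n
  ... | yes p with cover p
  ...   | x , q = ≤-trans (≤-reflexive (sym (cong ⟦_⟧ (dec-true (Q? x u) q))))
                            (≤-sum (λ x → ⟦ does (Q? x u) ⟧) x)

∑-supported-≤ : {P : Pred (Fin m) 0ℓ} (P? : Decidable P) (f : Fin m → ℕ) {c : ℕ} →
  (∀ x → ¬ P x → f x ≡ 0) → (∀ x → P x → f x ≤ c) → sum f ≤ count P? * c
∑-supported-≤ P? f {c} outside inside =
  ≤-trans (∑-mono-≤ pointwise) (≤-reflexive (sym (*-distribʳ-sum c (λ x → ⟦ does (P? x) ⟧))))
  where
  pointwise : ∀ x → f x ≤ ⟦ does (P? x) ⟧ * c
  pointwise x with P? x
  ... | yes p = ≤-trans (inside x p) (≤-reflexive (sym (+-identityʳ c)))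
  ... | no ¬p = ≤-reflexive (outside x ¬p)

count*count≤∑ : {P Q : Pred (Fin m) 0ℓ} {F : Fin k → Pred (Fin m) 0ℓ}
  (P? : Decidable P) (Q? : Decidable Q) (F? : ∀ x → Decidable (F x)) →
  (∀ {a b} → P a → Q b → ∃ λ x → F x a × F x b) →
  count P? * count Q? ≤ ∑[ x < k ] (count (P? ∩? F? x) * count (Q? ∩? F? x))
count*count≤∑ {m} {k} {P} {Q} P? Q? F? cover = begin
  count P? * count Q?
    ≡⟨ ∑*∑ (λ a → ⟦ does (P? a) ⟧) (λ b → ⟦ does (Q? b) ⟧) ⟩
  ∑[ a < m ] ∑[ b < m ] (⟦ does (P? a) ⟧ * ⟦ does (Q? b) ⟧)
    ≤⟨ ∑-mono-≤ (λ a → ∑-mono-≤ (pointwise a)) ⟩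
  ∑[ a < m ] ∑[ b < m ] ∑[ x < k ] term x a b
    ≡⟨ sum-cong-≗ (λ a → ∑-comm (λ b x → term x a b)) ⟩
  ∑[ a < m ] ∑[ x < k ] ∑[ b < m ] term x a b
    ≡⟨ ∑-comm (λ a x → ∑[ b < m ] term x a b) ⟩
  ∑[ x < k ] ∑[ a < m ] ∑[ b < m ] term x a b
    ≡⟨ sum-cong-≗ (λ x → sym (∑*∑ (λ a → ⟦ does ((P? ∩? F? x) a) ⟧)
                                  (λ b → ⟦ does ((Q? ∩? F? x) b) ⟧))) ⟩
  ∑[ x < k ] (count (P? ∩? F? x) * count (Q? ∩? F? x)) ∎
  where
  open ≤-Reasoning
  term : Fin k → Fin m → Fin m → ℕ
  term x a b = ⟦ does ((P? ∩? F? x) a) ⟧ * ⟦ does ((Q? ∩? F? x) b) ⟧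
  pointwise : ∀ a b → ⟦ does (P? a) ⟧ * ⟦ does (Q? b) ⟧ ≤ ∑[ x < k ] term x a b
  pointwise a b = covered (P? a) (Q? b)
    where
    covered : (Pa? : Dec (P a)) (Qb? : Dec (Q b)) → ⟦ does Pa? ⟧ * ⟦ does Qb? ⟧ ≤ ∑[ x < k ] term x a b
    covered (no _) _ = z≤n
    covered (yes _) (no _) = z≤n
    covered (yes p) (yes q) with cover p q
    ... | x , Fa , Fb = ≤-trans (≤-reflexive (sym term≡1)) (≤-sum (λ x → term x a b) x)
      where
      term≡1 : term x a b ≡ 1
      term≡1 = cong₂ (λ c d → ⟦ c ⟧ * ⟦ d ⟧)
        (dec-true ((P? ∩? F? x) a) (p , Fa)) (dec-true ((Q? ∩? F? x) b) (q , Fb))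

4*m*n≤[m+n]² : ∀ a b → 4 * (a * b) ≤ (a + b) * (a + b)
4*m*n≤[m+n]² a b with ≤-total a b
... | inj₁ a≤b with m≤n⇒∃[o]m+o≡n a≤b
...   | d , refl = ≤-trans (m≤m+n _ (d * d)) (≤-reflexive (solve 2 (λ a d →
          con 4 :* (a :* (a :+ d)) :+ d :* d := (a :+ (a :+ d)) :* (a :+ (a :+ d))) refl a d))
4*m*n≤[m+n]² a b | inj₂ b≤a with m≤n⇒∃[o]m+o≡n b≤a
...   | d , refl = ≤-trans (m≤m+n _ (d * d)) (≤-reflexive (solve 2 (λ b d →
          con 4 :* ((b :+ d) :* b) :+ d :* d := (b :+ d :+ b) :* (b :+ d :+ b)) refl b d))

n≤3x : ∀ {n x y} → n ≤ x + y → 3 * y ≤ 2 * n → n ≤ 3 * x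
n≤3x {n} {x} {y} n≤x+y 3y≤2n = +-cancelʳ-≤ (2 * n) n (3 * x) (begin
  n + 2 * n   ≡⟨ solve 1 (λ n → n :+ con 2 :* n := con 3 :* n) refl n ⟩
  3 * n       ≤⟨ *-monoʳ-≤ 3 n≤x+y ⟩
  3 * (x + y) ≡⟨ *-distribˡ-+ 3 x y ⟩
  3 * x + 3 * y ≤⟨ +-monoʳ-≤ (3 * x) 3y≤2n ⟩
  3 * x + 2 * n ∎)
  where open ≤-Reasoning

∣tabulate∣≡count : ∀ {m} (f : Fin m → Bool) → ∣ tabulate f ∣ ≡ count (λ i → f i Bool.≟ true)
∣tabulate∣≡count {zero} f = refl
∣tabulate∣≡count {suc m} f with f zero
... | true = cong suc (∣tabulate∣≡count (f ∘ suc))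
... | false = ∣tabulate∣≡count (f ∘ suc)

M-suc : ∀ Δ l → M Δ (suc l) ≡ M Δ l + Δ * (Δ ∸ 1) ^ l
M-suc Δ l = solve 3 (λ Δ g r → con 1 :+ Δ :* (g :+ r) := con 1 :+ Δ :* g :+ Δ :* r)
  refl Δ (geomSum (Δ ∸ 1) l) ((Δ ∸ 1) ^ l)

module _ {n} (G : Graph n) where

  Adj : Fin n → Pred (Fin n) 0ℓ
  Adj u v = adj G u v ≡ true

  adj? : ∀ u → Decidable (Adj u)
  adj? u v = adj G u v Bool.≟ true

  Adj-sym : ∀ {u v} → Adj u v → Adj v u
  Adj-sym {u} {v} e = trans (Graph.sym G v u) e

  deg≡count-adj : ∀ v → deg G v ≡ count (adj? v)
  deg≡count-adj v = ∣tabulate∣≡count (adj G v)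

  walk-weaken : ∀ {l l' u v} → l ≤ l' → WalkWithin G l u v → WalkWithin G l' u v
  walk-weaken _ here = here
  walk-weaken (s≤s l≤l') (step e w) = step e (walk-weaken l≤l' w)

  walk-snoc : ∀ {l u w v} → WalkWithin G l u w → Adj w v → WalkWithin G (suc l) u v
  walk-snoc here e = step e here
  walk-snoc (step e' w) e = step e' (walk-snoc w e)

  walk-reverse : ∀ {l u v} → WalkWithin G l u v → WalkWithin G l v u
  walk-reverse here = here
  walk-reverse (step e w) = walk-snoc (walk-reverse w) (Adj-sym e)

  walk-zero : ∀ {u v} → WalkWithin G 0 u v → u ≡ v
  walk-zero here = refl

  walkWithin? : ∀ l u v → Dec (WalkWithin G l u v)
  walkWithin? zero u v = map′ (λ { refl → here }) walk-zero (u Fin.≟ v)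
  walkWithin? (suc l) u v =
    map′ fromSplit toSplit ((u Fin.≟ v) ⊎-dec any? (λ w → adj? u w ×-dec walkWithin? l w v))
    where
    fromSplit : u ≡ v ⊎ ∃ (λ w → Adj u w × WalkWithin G l w v) → WalkWithin G (suc l) u v
    fromSplit (inj₁ refl) = here
    fromSplit (inj₂ (w , e , wk)) = step e wk
    toSplit : WalkWithin G (suc l) u v → u ≡ v ⊎ ∃ (λ w → Adj u w × WalkWithin G l w v)
    toSplit here = inj₁ refl
    toSplit (step e wk) = inj₂ (_ , e , wk)

  Ball : Fin n → ℕ → Pred (Fin n) 0ℓ
  Ball x l u = WalkWithin G l u x

  ball? : ∀ x l → Decidable (Ball x l)
  ball? x l u = walkWithin? l u x

  -- Sphere x l consists of the vertices at distance exactly l + 1 from x.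
  Sphere : Fin n → ℕ → Pred (Fin n) 0ℓ
  Sphere x l = Ball x (suc l) ∩ ∁ (Ball x l)

  sphere? : ∀ x l → Decidable (Sphere x l)
  sphere? x l = ball? x (suc l) ∩? ∁? (ball? x l)

  Sphere-inward : ∀ {x l u} → Sphere x l u → ∃ λ v → Adj u v × Ball x l v
  Sphere-inward (here , ¬Ball) = contradiction here ¬Ball
  Sphere-inward (step e w , _) = _ , e , w

  Sphere-parent : ∀ {x l u} → Sphere x (suc l) u → ∃ λ v → Sphere x l v × Adj v u
  Sphere-parent S@(_ , ¬Ball) with Sphere-inward S
  ... | v , e , w = v , (w , λ b → ¬Ball (step e b)) , Adj-sym e

  module _ {Δ : ℕ} (maxDeg : MaxDegreeAtMost G Δ) (x : Fin n) where

    count-adj≤Δ : ∀ v → count (adj? v) ≤ Δ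
    count-adj≤Δ v = subst (_≤ Δ) (deg≡count-adj v) (maxDeg v)

    -- A vertex on a sphere spends one of its edges on a neighbour closer to x.
    count-children≤ : ∀ {l v} → Sphere x l v → count (adj? v ∩? sphere? x (suc l)) ≤ Δ ∸ 1
    count-children≤ {l} {v} S with Sphere-inward S
    ... | _ , e , w = subst (count (adj? v ∩? sphere? x (suc l)) ≤_) (pred[m∸n]≡m∸[1+n] Δ 0)
                        (<⇒≤pred (≤-trans fewer (count-adj≤Δ v)))
      where
      fewer : count (adj? v ∩? sphere? x (suc l)) < count (adj? v)
      fewer = count-mono-< (adj? v ∩? sphere? x (suc l)) (adj? v) proj₁ e
        (λ (_ , _ , ¬Ball) → ¬Ball (walk-weaken (n≤1+n l) w))

    count-sphere≤ : ∀ l → count (sphere? x l) ≤ Δ * (Δ ∸ 1) ^ l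
    count-sphere≤ zero = begin
      count (sphere? x 0) ≤⟨ count-mono (sphere? x 0) (adj? x) neighbour ⟩
      count (adj? x)      ≤⟨ count-adj≤Δ x ⟩
      Δ                   ≡⟨ sym (*-identityʳ Δ) ⟩
      Δ * 1               ∎
      where
      open ≤-Reasoning
      neighbour : Sphere x 0 ⊆ Adj x
      neighbour S with Sphere-inward S
      ... | _ , e , here = Adj-sym e
    count-sphere≤ (suc l) = begin
      count (sphere? x (suc l))
        ≤⟨ count-≤-∑ (sphere? x (suc l)) children? (λ S → let v , S' , e = Sphere-parent S in v , S' , e , S) ⟩
      ∑[ v < n ] count (children? v)
        ≤⟨ ∑-supported-≤ (sphere? x l) (count ∘ children?)
             (λ v ¬S → count-none (children? v) (λ _ (S , _) → ¬S S))
             (λ v S → ≤-trans (count-mono (children? v) (adj? v ∩? sphere? x (suc l)) proj₂)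
                              (count-children≤ S)) ⟩
      count (sphere? x l) * (Δ ∸ 1)
        ≤⟨ *-monoˡ-≤ (Δ ∸ 1) (count-sphere≤ l) ⟩
      Δ * (Δ ∸ 1) ^ l * (Δ ∸ 1)
        ≡⟨ solve 3 (λ Δ r q → Δ :* r :* q := Δ :* (q :* r)) refl Δ ((Δ ∸ 1) ^ l) (Δ ∸ 1) ⟩
      Δ * (Δ ∸ 1) ^ suc l ∎
      where
      open ≤-Reasoning
      children? : ∀ v → Decidable (λ u → Sphere x l v × (Adj v ∩ Sphere x (suc l)) u)
      children? v u = sphere? x l v ×-dec (adj? v ∩? sphere? x (suc l)) u

    count-ball≤ : ∀ l → count (ball? x l) ≤ M Δ l
    count-ball≤ zero = subst (count (ball? x 0) ≤_) (cong suc (sym (*-zeroʳ Δ)))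
      (count-subsingleton (ball? x 0) (λ u≡x v≡x → trans (walk-zero u≡x) (sym (walk-zero v≡x))))
    count-ball≤ (suc l) = begin
      count (ball? x (suc l))
        ≤⟨ count-⊆-∪ (ball? x l) (sphere? x l) (ball? x (suc l)) (λ {u} → split u) ⟩
      count (ball? x l) + count (sphere? x l)
        ≤⟨ +-mono-≤ (count-ball≤ l) (count-sphere≤ l) ⟩
      M Δ l + Δ * (Δ ∸ 1) ^ l
        ≡⟨ sym (M-suc Δ l) ⟩
      M Δ (suc l) ∎
      where
      open ≤-Reasoning
      split : ∀ u → Ball x (suc l) u → (Ball x l ∪ Sphere x l) u
      split u b with ball? x l u
      ... | yes b' = inj₁ b'
      ... | no ¬b' = inj₂ (b , ¬b')

∣p∣≡count : ∀ {m} (p : Subset m) → ∣ p ∣ ≡ count (_∈? p)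
∣p∣≡count [] = refl
∣p∣≡count (true ∷ p) = cong suc (∣p∣≡count p)
∣p∣≡count (false ∷ p) = ∣p∣≡count p

module Separation {n} {G : Graph n} {s} {A S B : Subset n} (sep : IsSeparation G s A S B) where
  open IsSeparation sep

  ∈A⇒∉B : ∀ {v} → v ∈ A → v ∉ B
  ∈A⇒∉B {v} v∈A with partition v
  ... | inj₁ (_ , _ , v∉B) = v∉B
  ... | inj₂ (inj₁ (v∉A , _)) = contradiction v∈A v∉A
  ... | inj₂ (inj₂ (v∉A , _)) = contradiction v∈A v∉A

  ∈A∪S∪B : ∀ v → v ∈ A ⊎ v ∈ S ⊎ v ∈ B
  ∈A∪S∪B v with partition v
  ... | inj₁ (v∈A , _) = inj₁ v∈A
  ... | inj₂ (inj₁ (_ , v∈S , _)) = inj₂ (inj₁ v∈S)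
  ... | inj₂ (inj₂ (_ , _ , v∈B)) = inj₂ (inj₂ v∈B)

  ∈B∪S∪A : ∀ v → v ∈ B ⊎ v ∈ S ⊎ v ∈ A
  ∈B∪S∪A v with ∈A∪S∪B v
  ... | inj₁ v∈A = inj₂ (inj₂ v∈A)
  ... | inj₂ (inj₁ v∈S) = inj₂ (inj₁ v∈S)
  ... | inj₂ (inj₂ v∈B) = inj₁ v∈B

  record WalkThroughS (l : ℕ) (a b : Fin n) : Set where
    field
      {centre} : Fin n
      centre∈S : centre ∈ S
      {d₁ d₂} : ℕ
      d₁+d₂≤l : d₁ + d₂ ≤ l
      a→centre : WalkWithin G d₁ a centre
      centre→b : WalkWithin G d₂ centre b

  walk-through-S : ∀ {l a b} → WalkWithin G l a b → a ∈ A → b ∈ B → WalkThroughS l a b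
  walk-through-S here a∈A a∈B = contradiction a∈B (∈A⇒∉B a∈A)
  walk-through-S {suc l} {a} (step {w = w} e walk) a∈A b∈B with ∈A∪S∪B w
  ... | inj₂ (inj₁ w∈S) = record
    { centre∈S = w∈S ; d₁+d₂≤l = ≤-refl ; a→centre = step e here ; centre→b = walk }
  ... | inj₂ (inj₂ w∈B) with () ← trans (sym e) (noEdge a w a∈A w∈B)
  ... | inj₁ w∈A = record
    { centre∈S = centre∈S ; d₁+d₂≤l = s≤s d₁+d₂≤l ; a→centre = step e a→centre ; centre→b = centre→b }
    where open WalkThroughS (walk-through-S walk w∈A b∈B)

module Bounds {n} {G : Graph n} {Δ} (maxDeg : MaxDegreeAtMost G Δ)
              {s} {A S B : Subset n} (sep : IsSeparation G s A S B) (j : ℕ) where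
  open IsSeparation sep
  open Separation sep

  Near : Pred (Fin n) 0ℓ
  Near u = ∃ λ x → x ∈ S × Ball G x j u

  near? : Decidable Near
  near? u = any? (λ x → (x ∈? S) ×-dec ball? G x j u)

  count-near≤ : count near? ≤ s * M Δ j
  count-near≤ = begin
    count near?
      ≤⟨ count-≤-∑ near? ball-around? id ⟩
    ∑[ x < n ] count (ball-around? x)
      ≤⟨ ∑-supported-≤ (_∈? S) (count ∘ ball-around?)
           (λ x x∉S → count-none (ball-around? x) (λ _ (x∈S , _) → x∉S x∈S))
           (λ x _ → ≤-trans (count-mono (ball-around? x) (ball? G x j) proj₂) (count-ball≤ G maxDeg x j)) ⟩
    count (_∈? S) * M Δ j
      ≤⟨ *-monoˡ-≤ (M Δ j) (subst (_≤ s) (∣p∣≡count S) sizeS) ⟩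
    s * M Δ j ∎
    where
    open ≤-Reasoning
    ball-around? : ∀ x → Decidable (λ u → x ∈ S × Ball G x j u)
    ball-around? x u = (x ∈? S) ×-dec ball? G x j u

  Far : Subset n → Pred (Fin n) 0ℓ
  Far X u = u ∈ X × ¬ Near u

  far? : ∀ X → Decidable (Far X)
  far? X u = (u ∈? X) ×-dec ¬? (near? u)

  far-large : ∀ {X Y} → (∀ v → v ∈ X ⊎ v ∈ S ⊎ v ∈ Y) → 3 * ∣ Y ∣ ≤ 2 * n →
    n ∸ 3 * s * M Δ j ≤ 3 * count (far? X)
  far-large {X} {Y} cover 3Y≤2n = m≤n+o⇒m∸n≤o n (3 * s * M Δ j) (begin
    n                                 ≤⟨ n≤3x {n} {count (far? X) + count near?} n≤
                                             (subst (λ c → 3 * c ≤ 2 * n) (∣p∣≡count Y) 3Y≤2n) ⟩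
    3 * (count (far? X) + count near?) ≤⟨ *-monoʳ-≤ 3 (+-monoʳ-≤ (count (far? X)) count-near≤) ⟩
    3 * (count (far? X) + s * M Δ j)   ≡⟨ solve 3 (λ f s m → con 3 :* (f :+ s :* m) := con 3 :* s :* m :+ con 3 :* f)
                                              refl (count (far? X)) s (M Δ j) ⟩
    3 * s * M Δ j + 3 * count (far? X) ∎)
    where
    open ≤-Reasoning
    split : ∀ v → ((Far X ∪ Near) ∪ (_∈ Y)) v
    split v with cover v | near? v
    ... | inj₁ v∈X | no ¬near = inj₁ (inj₁ (v∈X , ¬near))
    ... | inj₁ _ | yes near = inj₁ (inj₂ near)
    ... | inj₂ (inj₁ v∈S) | _ = inj₁ (inj₂ (v , v∈S , here))
    ... | inj₂ (inj₂ v∈Y) | _ = inj₂ v∈Y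
    n≤ : n ≤ count (far? X) + count near? + count (_∈? Y)
    n≤ = begin
      n ≡⟨ sym (count-all {n} U? _) ⟩
      count {n} U? ≤⟨ count-⊆-∪ (far? X ∪? near?) (_∈? Y) U? (λ {v} _ → split v) ⟩
      count (far? X ∪? near?) + count (_∈? Y)
        ≤⟨ +-monoˡ-≤ (count (_∈? Y)) (count-⊆-∪ (far? X) near? (far? X ∪? near?) id) ⟩
      count (far? X) + count near? + count (_∈? Y) ∎

  far-walk-long : ∀ {X a x i} → Far X a → x ∈ S → WalkWithin G i a x → j < i
  far-walk-long {i = i} (_ , ¬near) x∈S walk with j <? i
  ... | yes j<i = j<i
  ... | no j≮i = contradiction (_ , x∈S , walk-weaken G (≮⇒≥ j≮i) walk) ¬near

  far-sides-apart : DiameterAtMost G (2 * j + 1) → ∀ {a b} → Far A a → Far B b → ⊥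
  far-sides-apart diam {a} {b} farA farB = 1+n≰n (begin
    suc (2 * j + 1) ≡⟨ solve 1 (λ j → con 1 :+ (con 2 :* j :+ con 1) := con 1 :+ j :+ (con 1 :+ j)) refl j ⟩
    suc j + suc j   ≤⟨ +-mono-≤ (far-walk-long farA centre∈S a→centre)
                                (far-walk-long farB centre∈S (walk-reverse G centre→b)) ⟩
    d₁ + d₂         ≤⟨ d₁+d₂≤l ⟩
    2 * j + 1       ∎)
    where
    open ≤-Reasoning
    open WalkThroughS (walk-through-S (diam a b) (proj₁ farA) (proj₁ farB))

  OnSphere : Fin n → Pred (Fin n) 0ℓ
  OnSphere x u = x ∈ S × Sphere G x j u

  onSphere? : ∀ x → Decidable (OnSphere x)
  onSphere? x u = (x ∈? S) ×-dec sphere? G x j u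

  far-pair-on-sphere : DiameterAtMost G (2 * j + 2) →
    ∀ {a b} → Far A a → Far B b → ∃ λ x → OnSphere x a × OnSphere x b
  far-pair-on-sphere diam {a} {b} farA farB =
    centre , (centre∈S , walk-weaken G d₁≤1+j a→centre , λ w → proj₂ farA (centre , centre∈S , w))
           , (centre∈S , walk-weaken G d₂≤1+j b→centre , λ w → proj₂ farB (centre , centre∈S , w))
    where
    open WalkThroughS (walk-through-S (diam a b) (proj₁ farA) (proj₁ farB))
    b→centre : WalkWithin G d₂ b centre
    b→centre = walk-reverse G centre→b
    d₁+d₂≤ : d₁ + d₂ ≤ suc j + suc j
    d₁+d₂≤ = ≤-trans d₁+d₂≤l
      (≤-reflexive (solve 1 (λ j → con 2 :* j :+ con 2 := con 1 :+ j :+ (con 1 :+ j)) refl j))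
    d₁≤1+j : d₁ ≤ suc j
    d₁≤1+j = +-cancelʳ-≤ (suc j) d₁ (suc j)
      (≤-trans (+-monoʳ-≤ d₁ (far-walk-long farB centre∈S b→centre)) d₁+d₂≤)
    d₂≤1+j : d₂ ≤ suc j
    d₂≤1+j = +-cancelˡ-≤ (suc j) d₂ (suc j)
      (≤-trans (+-monoˡ-≤ d₂ (far-walk-long farA centre∈S a→centre)) d₁+d₂≤)

  D : ℕ
  D = Δ * (Δ ∸ 1) ^ j

  far-on-sphere-≤ : ∀ x → x ∈ S →
    4 * (count (far? A ∩? onSphere? x) * count (far? B ∩? onSphere? x)) ≤ D * D
  far-on-sphere-≤ x _ = begin
    4 * (α * β)       ≤⟨ 4*m*n≤[m+n]² α β ⟩
    (α + β) * (α + β) ≤⟨ *-mono-≤ α+β≤D α+β≤D ⟩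
    D * D             ∎
    where
    open ≤-Reasoning
    α β : ℕ
    α = count (far? A ∩? onSphere? x)
    β = count (far? B ∩? onSphere? x)
    α+β≤D : α + β ≤ D
    α+β≤D = ≤-trans
      (count-disjoint-⊆ (far? A ∩? onSphere? x) (far? B ∩? onSphere? x) (onSphere? x) proj₂ proj₂
        (λ ((a∈A , _) , _) ((a∈B , _) , _) → ∈A⇒∉B a∈A a∈B))
      (≤-trans (count-mono (onSphere? x) (sphere? G x j) proj₂) (count-sphere≤ G maxDeg x j))

  count-far*count-far≤ : DiameterAtMost G (2 * j + 2) → 4 * (count (far? A) * count (far? B)) ≤ s * (D * D)
  count-far*count-far≤ diam = begin
    4 * (count (far? A) * count (far? B))
      ≤⟨ *-monoʳ-≤ 4 (count*count≤∑ (far? A) (far? B) onSphere? (far-pair-on-sphere diam)) ⟩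
    4 * ∑[ x < n ] (α x * β x)
      ≡⟨ *-distribˡ-sum 4 (λ x → α x * β x) ⟩
    ∑[ x < n ] (4 * (α x * β x))
      ≤⟨ ∑-supported-≤ (_∈? S) (λ x → 4 * (α x * β x)) off-S far-on-sphere-≤ ⟩
    count (_∈? S) * (D * D)
      ≤⟨ *-monoˡ-≤ (D * D) (subst (_≤ s) (∣p∣≡count S) sizeS) ⟩
    s * (D * D) ∎
    where
    open ≤-Reasoning
    α β : Fin n → ℕ
    α x = count (far? A ∩? onSphere? x)
    β x = count (far? B ∩? onSphere? x)
    off-S : ∀ x → x ∉ S → 4 * (α x * β x) ≡ 0
    off-S x x∉S rewrite count-none (far? A ∩? onSphere? x) (λ _ (_ , x∈S , _) → x∉S x∈S) = refl

  bound-odd : DiameterAtMost G (2 * j + 1) → n ≤ 3 * s * M Δ j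
  bound-odd diam = m∸n≡0⇒m≤n (n≤0⇒n≡0 n∸3sM≤0)
    where
    n∸3sM≤0 : n ∸ 3 * s * M Δ j ≤ 0
    n∸3sM≤0 with any? (far? A)
    ... | yes (_ , farA) = subst (λ c → _ ≤ 3 * c)
          (count-none (far? B) (λ _ farB → far-sides-apart diam farA farB)) (far-large ∈B∪S∪A sizeA)
    ... | no noFarA = subst (λ c → _ ≤ 3 * c)
          (count-none (far? A) (λ a farA → noFarA (a , farA))) (far-large ∈A∪S∪B sizeB)

  bound-even : DiameterAtMost G (2 * j + 2) → (2 * (n ∸ 3 * s * M Δ j)) ^ 2 ≤ 9 * s * D ^ 2
  bound-even diam = begin
    (2 * t) ^ 2           ≡⟨ solve 1 (λ t → (con 2 :* t) :^ 2 := con 4 :* (t :* t)) refl t ⟩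
    4 * (t * t)           ≤⟨ *-monoʳ-≤ 4 (*-mono-≤ (far-large ∈A∪S∪B sizeB) (far-large ∈B∪S∪A sizeA)) ⟩
    4 * (3 * a * (3 * b)) ≡⟨ solve 2 (λ a b → con 4 :* (con 3 :* a :* (con 3 :* b)) := con 9 :* (con 4 :* (a :* b)))
                                   refl a b ⟩
    9 * (4 * (a * b))     ≤⟨ *-monoʳ-≤ 9 (count-far*count-far≤ diam) ⟩
    9 * (s * (D * D))     ≡⟨ solve 2 (λ s d → con 9 :* (s :* (d :* d)) := con 9 :* s :* d :^ 2) refl s D ⟩
    9 * s * D ^ 2         ∎
    where
    open ≤-Reasoning
    t a b : ℕ
    t = n ∸ 3 * s * M Δ j
    a = count (far? A)
    b = count (far? B)

mainTheorem7 : (Δ k n s : ℕ) → 3 ≤ Δ → (G : Graph n) →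
    MaxDegreeAtMost G Δ → DiameterAtMost G k →
    (A S B : Subset n) → IsSeparation G s A S B →
    ((j : ℕ) → k ≡ 2 * j + 1 → n ≤ 3 * s * M Δ j)
    × ((j : ℕ) → k ≡ 2 * j + 2 →
       (2 * (n ∸ 3 * s * M Δ j)) ^ 2 ≤ 9 * s * (Δ * (Δ ∸ 1) ^ j) ^ 2)
mainTheorem7 Δ k n s _ G maxDeg diam A S B sep =
  (λ j k≡2j+1 → Bounds.bound-odd maxDeg sep j (subst (DiameterAtMost G) k≡2j+1 diam)) ,
  (λ j k≡2j+2 → Bounds.bound-even maxDeg sep j (subst (DiameterAtMost G) k≡2j+2 diam))
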